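{- Let $f(x)=ax^2+bx+c$ with $a,b,c\in\mathbb Z$, $a\neq0$, put $d=b^2-4ac$, and let $p$ be an odd prime not dividing all of $a,b,c$. Then $$a_p(f)=\begin{cases}\dfrac{ -\left(\frac{a}{p}\right)}{p-1-\left(\frac{d}{p}\right)} & \text{if } p\nmid ad;\\ 0 & \text{if } p\mid a,\ p\nmid d;\\ \left(\frac{a}{p}\right) & \text{if } p\nmid a,\ p\mid d;\\ \left(\frac{c}{p}\right) & \text{if } p\mid a \text{ and } p\mid d.\end{cases}$$
   Context: $\left(\frac{\cdot}{p}\right)$ is the Legendre symbol, and $$a_p(f)=\frac{\sum_{r \bmod p}\left(\frac{f(r)}{p}\right)}{\#\{r\bmod p:\ \gcd(f(r),p)=1\}}.$$ -}

module Defs where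

open import Data.Nat as ℕ using (ℕ; zero; suc)
open import Data.Integer as ℤ using (ℤ; +_; _%ℕ_)
open import Data.Integer.Divisibility using (_∣_)
open import Data.List using (List; map; foldr; length; filter; upTo)
open import Data.Bool.ListAction using (any)
open import Data.Nat.GCD using (gcd)
open import Data.Bool using (Bool; true; false; if_then_else_)
open import Data.Rational as ℚ using (ℚ; _/_)
open import Relation.Nullary.Decidable using (⌊_⌋)

legendre : ℤ → (p : ℕ) → .{{_ : ℕ.NonZero p}} → ℤ
legendre x p with x %ℕ p
... | zero = + 0
... | suc k =
  if any (λ y → ⌊ (y ℕ.* y) ℕ.% p ℕ.≟ suc k ⌋) (upTo p)
  then + 1 else ℤ.- (+ 1)

quad : ℤ → ℤ → ℤ → ℤ → ℤ
quad a b c x = a ℤ.* x ℤ.* x ℤ.+ b ℤ.* x ℤ.+ c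

-- rational division returning 0 when the denominator is 0 (never happens where used)
divℚ : ℤ → ℤ → ℚ
divℚ n (+ zero) = ℚ.0ℚ
divℚ n (+ suc m) = n / suc m
divℚ n (ℤ.-[1+ m ]) = (ℤ.- n) / suc m

sumℤ : List ℤ → ℤ
sumℤ = foldr ℤ._+_ (+ 0)

residues : ℕ → List ℤ
residues p = map +_ (upTo p)

apQuad : ℤ → ℤ → ℤ → (p : ℕ) → .{{_ : ℕ.NonZero p}} → ℚ
apQuad a b c p =
  divℚ (sumℤ (map (λ r → legendre (quad a b c r) p) (residues p)))
       (+ length (filter (λ r → gcd ℤ.∣ quad a b c r ∣ p ℕ.≟ 1) (residues p)))

module Submission where

-- Write χ for the Legendre symbol mod p and ∑ₚ for a sum over the residues mod p.
-- Completing the square, 4a·f(x) = (2ax + b)² − d, so when p ∤ a the substitution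
-- u = 2ax + b gives ∑ₚ χ(f) = χ(a)·∑ₚ χ(u² − d) and #{x : f(x) ≡ 0} = #{u : u² ≡ d} = 1 + χ(d).
-- Counting the pairs (u, y) with u² − d ≡ y² shows ∑ₚ χ(u² − d) = −1 when p ∤ d, while
-- ∑ₚ χ(u²) = p − 1.  When p ∣ a, f is congruent to bx + c, and p ∣ d exactly when p ∣ b:
-- then f is the constant c, otherwise its values run once through all residues.

open import Defs

open import Data.Bool using (Bool; T; if_then_else_)
open import Data.Bool.ListAction using (any)
open import Data.Bool.Properties using (T-≡; ¬-not)
open import Data.Empty using (⊥-elim)
open import Data.Fin using (Fin; zero; suc; toℕ; fromℕ<)
import Data.Fin.Properties as FinP
open import Data.Fin.Permutation using (Permutation′; permutation; _⟨$⟩ʳ_)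
open import Data.Integer as ℤ using (ℤ; +_; -_; _+_; _-_; _*_; _≤_; _%ℕ_; ∣_∣)
open import Data.Integer.Divisibility using (_∣_)
import Data.Integer.Divisibility.Signed as S
open import Data.Integer.DivMod using (a≡a%ℕn+[a/ℕn]*n; n%ℕd<d)
import Data.Integer.Properties as ℤP
open import Data.Integer.Tactic.RingSolver using (solve-∀)
open import Data.List using ([]; _∷_; upTo; applyUpTo; map; length; filter)
open import Data.List.Membership.Propositional using (lose)
open import Data.List.Membership.Propositional.Properties using (∈-upTo⁺)
open import Data.List.Relation.Unary.Any using (satisfied)
open import Data.List.Relation.Unary.Any.Properties using (any⁺; any⁻)
open import Data.Nat as ℕ using (ℕ; zero; suc)
open import Data.Nat.Coprimality using (coprime-Bézout; prime⇒coprime)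
import Data.Nat.Divisibility as ℕD
import Data.Nat.DivMod as ℕDM
open import Data.Nat.GCD using (module Bézout; gcd; gcd-greatest; gcd[m,n]∣m; gcd[m,n]∣n)
open import Data.Nat.Primality
  using (Prime; euclidsLemma; irreducible[2]; prime⇒nonTrivial; prime⇒irreducible)
import Data.Nat.Properties as ℕP
open import Data.Product using (∃; _×_; _,_)
import Data.Rational as ℚ
import Data.Rational.Properties as ℚP
import Data.Rational.Unnormalised as ℚᵘ
open import Data.Sum using (_⊎_; inj₁; inj₂; [_,_]′)
open import Data.Vec.Functional using (Vector)
open import Function using (id; _∘_; _⇔_; mk⇔; Equivalence)
open import Level using (0ℓ)
open import Relation.Binary using (Setoid; _Preserves_⟶_)
open import Relation.Binary.PropositionalEquality
import Relation.Binary.Reasoning.Setoid as SetoidReasoning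
open import Relation.Nullary using (¬_; Dec; yes; no)
open import Relation.Nullary.Decidable using (⌊_⌋; ¬?; toWitness; fromWitness; T?)
  renaming (map to Dec-map)
open import Relation.Unary using (Pred; Decidable)

open import Algebra.Properties.Semiring.Sum ℤP.+-*-semiring
  using (sum-syntax; sum-cong-≗; sum-replicate-zero; ∑-distrib-+; ∑-comm; *-distribˡ-sum; ∑-permute)

∑-const : ∀ n x → ∑[ i < n ] x ≡ + n * x
∑-const zero    x = refl
∑-const (suc n) x = trans (cong (_+_ x) (∑-const n x)) (lemma x (+ n))
  where lemma : ∀ x n → x + n * x ≡ (+ 1 + n) * x
        lemma = solve-∀

∑-distrib-- : ∀ {n} (f g : Vector ℤ n) → ∑[ i < n ] (f i - g i) ≡ ∑[ i < n ] f i - ∑[ i < n ] g i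
∑-distrib-- {n} f g = trans (∑-distrib-+ {n} f (λ i → - g i)) (cong (_+_ (∑[ i < n ] f i)) ∑-g)
  where
    open ≡-Reasoning
    ∑-g : ∑[ i < n ] (- g i) ≡ - ∑[ i < n ] g i
    ∑-g = begin
      ∑[ i < n ] (- g i)          ≡⟨ sum-cong-≗ {n} {λ i → - + 1 * g i} {λ i → - g i} (ℤP.-1*i≡-i ∘ g) ⟨
      ∑[ i < n ] (- + 1 * g i)    ≡⟨ *-distribˡ-sum {n} (- + 1) g ⟨
      - + 1 * ∑[ i < n ] g i      ≡⟨ ℤP.-1*i≡-i _ ⟩
      - ∑[ i < n ] g i            ∎

∑-single : ∀ {n} (f : Vector ℤ n) j → (∀ i → i ≢ j → f i ≡ + 0) → ∑[ i < n ] f i ≡ f j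
∑-single {suc n} f zero f≡0 = trans (cong (_+_ (f zero)) rest≡0) (ℤP.+-identityʳ _)
  where rest≡0 = trans (sum-cong-≗ {n} {f ∘ suc} {λ _ → + 0} (λ i → f≡0 (suc i) λ ()))
                       (sum-replicate-zero n)
∑-single {suc n} f (suc j) f≡0 = trans
  (cong (_+ ∑[ i < n ] f (suc i)) (f≡0 zero λ ()))
  (trans (ℤP.+-identityˡ _)
         (∑-single (f ∘ suc) j (λ i i≢j → f≡0 (suc i) (i≢j ∘ FinP.suc-injective))))

nonpos-+-≡0 : ∀ {x y} → x ≤ + 0 → y ≤ + 0 → x + y ≡ + 0 → x ≡ + 0 × y ≡ + 0
nonpos-+-≡0 {x} {y} x≤0 y≤0 x+y≡0 =
  x≡0 , trans (sym (ℤP.+-identityˡ y)) (subst (λ t → t + y ≡ + 0) x≡0 x+y≡0)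
  where
    x≡0 : x ≡ + 0
    x≡0 = ℤP.≤-antisym x≤0 (subst₂ _≤_ x+y≡0 (ℤP.+-identityʳ x) (ℤP.+-monoʳ-≤ x y≤0))

∑-nonpos : ∀ {n} (f : Vector ℤ n) → (∀ i → f i ≤ + 0) → ∑[ i < n ] f i ≤ + 0
∑-nonpos {zero}  f f≤0 = ℤP.≤-refl
∑-nonpos {suc n} f f≤0 = ℤP.+-mono-≤ (f≤0 zero) (∑-nonpos (f ∘ suc) (f≤0 ∘ suc))

∑-nonpos-≡0 : ∀ {n} (f : Vector ℤ n) → (∀ i → f i ≤ + 0) → ∑[ i < n ] f i ≡ + 0 → ∀ i → f i ≡ + 0
∑-nonpos-≡0 {suc n} f f≤0 ∑f≡0 i
  with nonpos-+-≡0 (f≤0 zero) (∑-nonpos (f ∘ suc) (f≤0 ∘ suc)) ∑f≡0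
∑-nonpos-≡0 {suc n} f f≤0 ∑f≡0 zero    | f0≡0 , _ = f0≡0
∑-nonpos-≡0 {suc n} f f≤0 ∑f≡0 (suc i) | _ , ∑f'≡0 = ∑-nonpos-≡0 (f ∘ suc) (f≤0 ∘ suc) ∑f'≡0 i

𝟙 : ∀ {A : Set} → Dec A → ℤ
𝟙 (yes _) = + 1
𝟙 (no _)  = + 0

𝟙-yes : ∀ {A : Set} {a? : Dec A} → A → 𝟙 a? ≡ + 1
𝟙-yes {a? = yes _} _ = refl
𝟙-yes {a? = no ¬a} a = ⊥-elim (¬a a)

𝟙-no : ∀ {A : Set} {a? : Dec A} → ¬ A → 𝟙 a? ≡ + 0
𝟙-no {a? = yes a} ¬a = ⊥-elim (¬a a)
𝟙-no {a? = no _}  _  = refl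

𝟙-⇔ : ∀ {A B : Set} {a? : Dec A} {b? : Dec B} → A ⇔ B → 𝟙 a? ≡ 𝟙 b?
𝟙-⇔ {a? = yes a} A⇔B = sym (𝟙-yes (Equivalence.to A⇔B a))
𝟙-⇔ {a? = no ¬a} A⇔B = sym (𝟙-no (¬a ∘ Equivalence.from A⇔B))

𝟙-¬ : ∀ {A : Set} (a? : Dec A) → 𝟙 (¬? a?) ≡ + 1 - 𝟙 a?
𝟙-¬ (yes _) = refl
𝟙-¬ (no _)  = refl

length-filter : ∀ {A : Set} {P : Pred A 0ℓ} (P? : Decidable P) xs →
                + length (filter P? xs) ≡ sumℤ (map (𝟙 ∘ P?) xs)
length-filter P? []       = refl
length-filter P? (x ∷ xs) with P? x
... | yes _ = cong (_+_ (+ 1)) (length-filter P? xs)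
... | no _  = trans (length-filter P? xs) (sym (ℤP.+-identityˡ _))

sumℤ-applyUpTo : ∀ (F : ℤ → ℤ) (h : ℕ → ℕ) n →
                 sumℤ (map F (map +_ (applyUpTo h n))) ≡ ∑[ i < n ] F (+ h (toℕ i))
sumℤ-applyUpTo F h zero    = refl
sumℤ-applyUpTo F h (suc n) = cong (_+_ (F (+ h 0))) (sumℤ-applyUpTo F (h ∘ suc) n)

divℚ-*-cancelʳ : ∀ i n .{{_ : ℕ.NonZero n}} → divℚ (i * + n) (+ n) ≡ i ℚ./ 1
divℚ-*-cancelʳ i (suc n) =
  ℚP.fromℚᵘ-cong {ℚᵘ.mkℚᵘ (i * + suc n) n} {ℚᵘ.mkℚᵘ i 0} (ℚᵘ.*≡* (ℤP.*-identityʳ _))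

module Congruence (p : ℕ) .{{_ : ℕ.NonZero p}} where

  infix 4 _≈_ _≉_ _≈?_
  record _≈_ (x y : ℤ) : Set where
    constructor mk≈
    field p∣x-y : + p S.∣ x - y

  _≉_ : ℤ → ℤ → Set
  x ≉ y = ¬ x ≈ y

  ≈-via : ∀ {x y z} → x - y ≡ z → + p S.∣ z → x ≈ y
  ≈-via eq p∣z = mk≈ (subst (+ p S.∣_) (sym eq) p∣z)

  ≡⇒≈ : ∀ {x y} → x ≡ y → x ≈ y
  ≡⇒≈ {x} refl = ≈-via (ℤP.+-inverseʳ x) (S.divides (+ 0) refl)

  ≈-refl : ∀ {x} → x ≈ x
  ≈-refl = ≡⇒≈ refl

  ≈-sym : ∀ {x y} → x ≈ y → y ≈ x
  ≈-sym {x} {y} (mk≈ d) = ≈-via (lemma x y) (S.∣m⇒∣-m d)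
    where lemma : ∀ x y → y - x ≡ - (x - y)
          lemma = solve-∀

  ≈-trans : ∀ {x y z} → x ≈ y → y ≈ z → x ≈ z
  ≈-trans {x} {y} {z} (mk≈ d) (mk≈ e) = ≈-via (lemma x y z) (S.∣m∣n⇒∣m+n d e)
    where lemma : ∀ x y z → x - z ≡ (x - y) + (y - z)
          lemma = solve-∀

  ≈-setoid : Setoid _ _
  ≈-setoid = record
    { Carrier = ℤ ; _≈_ = _≈_
    ; isEquivalence = record { refl = ≈-refl ; sym = ≈-sym ; trans = ≈-trans } }

  +-cong : ∀ {x y u v} → x ≈ y → u ≈ v → x + u ≈ y + v
  +-cong {x} {y} {u} {v} (mk≈ d) (mk≈ e) = ≈-via (lemma x y u v) (S.∣m∣n⇒∣m+n d e)
    where lemma : ∀ x y u v → (x + u) - (y + v) ≡ (x - y) + (u - v)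
          lemma = solve-∀

  *-cong : ∀ {x y u v} → x ≈ y → u ≈ v → x * u ≈ y * v
  *-cong {x} {y} {u} {v} (mk≈ d) (mk≈ e) =
    ≈-via (lemma x y u v) (S.∣m∣n⇒∣m+n (S.∣m⇒∣m*n u d) (S.∣n⇒∣m*n y e))
    where lemma : ∀ x y u v → x * u - y * v ≡ (x - y) * u + y * (u - v)
          lemma = solve-∀

  -‿cong : ∀ {x y} → x ≈ y → - x ≈ - y
  -‿cong {x} {y} (mk≈ d) = ≈-via (lemma x y) (S.∣m⇒∣-m d)
    where lemma : ∀ x y → - x - - y ≡ - (x - y)
          lemma = solve-∀

  ∣⇒≈0 : ∀ {x} → + p S.∣ x → x ≈ + 0
  ∣⇒≈0 {x} d = ≈-via (ℤP.+-identityʳ x) d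

  ≈0⇒∣ : ∀ {x} → x ≈ + 0 → + p S.∣ x
  ≈0⇒∣ {x} (mk≈ d) = subst (+ p S.∣_) (ℤP.+-identityʳ x) d

  ∣ᵤ⇒≈0 : ∀ {x} → + p ∣ x → x ≈ + 0
  ∣ᵤ⇒≈0 = ∣⇒≈0 ∘ S.∣ᵤ⇒∣

  ≈0⇒∣ᵤ : ∀ {x} → x ≈ + 0 → + p ∣ x
  ≈0⇒∣ᵤ = S.∣⇒∣ᵤ ∘ ≈0⇒∣

  *-≈0ˡ : ∀ {x} y → x ≈ + 0 → x * y ≈ + 0
  *-≈0ˡ {x} y x≈0 = ≈-trans (*-cong x≈0 (≈-refl {y})) (≡⇒≈ (ℤP.*-zeroˡ y))

  *-≈0ʳ : ∀ x {y} → y ≈ + 0 → x * y ≈ + 0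
  *-≈0ʳ x {y} y≈0 = ≈-trans (*-cong (≈-refl {x}) y≈0) (≡⇒≈ (ℤP.*-zeroʳ x))

  opaque
    _≈?_ : ∀ x y → Dec (x ≈ y)
    x ≈? y with + p S.∣? (x - y)
    ... | yes d = yes (mk≈ d)
    ... | no ¬d = no (λ (mk≈ d) → ¬d d)

  %ℕ-≈ : ∀ x → + (x %ℕ p) ≈ x
  %ℕ-≈ x = ≈-via (begin
      + r - x                ≡⟨ cong (λ t → + r - t) (a≡a%ℕn+[a/ℕn]*n x p) ⟩
      + r - (+ r + q * + p)  ≡⟨ lemma (+ r) q (+ p) ⟩
      - q * + p              ∎)
    (S.∣n⇒∣m*n (- q) S.∣-refl)
    where
      open ≡-Reasoning
      r = x %ℕ p
      q = x ℤ./ℕ p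
      lemma : ∀ r q p → r - (r + q * p) ≡ - q * p
      lemma = solve-∀

  p∣i∧∣i∣<p⇒i≡0 : ∀ {i} → + p S.∣ i → ∣ i ∣ ℕ.< p → i ≡ + 0
  p∣i∧∣i∣<p⇒i≡0 {i} p∣i ∣i∣<p = ℤP.∣i∣≡0⇒i≡0
    (trans (sym (ℕDM.m<n⇒m%n≡m ∣i∣<p)) (ℕD.n∣m⇒m%n≡0 ∣ i ∣ p (S.∣⇒∣ᵤ p∣i)))

  residue : ℤ → Fin p
  residue x = fromℕ< (n%ℕd<d x p)

  residue-≈ : ∀ x → + toℕ (residue x) ≈ x
  residue-≈ x = subst (λ n → + n ≈ x) (sym (FinP.toℕ-fromℕ< (n%ℕd<d x p))) (%ℕ-≈ x)

  +toℕ-injective : ∀ {i j : Fin p} → + toℕ i ≈ + toℕ j → i ≡ j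
  +toℕ-injective {i} {j} (mk≈ p∣i-j) = FinP.toℕ-injective (ℤP.+-injective
    (ℤP.i-j≡0⇒i≡j (+ m) (+ n) (p∣i∧∣i∣<p⇒i≡0 p∣i-j ∣i-j∣<p)))
    where
      m = toℕ i
      n = toℕ j
      ∣i-j∣<p : ∣ + m - + n ∣ ℕ.< p
      ∣i-j∣<p = ℕP.≤-<-trans
        (subst (ℕ._≤ m ℕ.⊔ n) (cong ∣_∣ (sym (ℤP.m-n≡m⊖n m n))) (ℤP.∣m⊝n∣≤m⊔n m n))
        (ℕP.⊔-lub (FinP.toℕ<n i) (FinP.toℕ<n j))

  residue-cong : ∀ {x y} → x ≈ y → residue x ≡ residue y
  residue-cong {x} {y} x≈y =
    +toℕ-injective (≈-trans (residue-≈ x) (≈-trans x≈y (≈-sym (residue-≈ y))))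

  residue-toℕ : ∀ (i : Fin p) → residue (+ toℕ i) ≡ i
  residue-toℕ i = +toℕ-injective (residue-≈ (+ toℕ i))

  %ℕ-cong : ∀ {x y} → x ≈ y → x %ℕ p ≡ y %ℕ p
  %ℕ-cong {x} {y} x≈y = begin
    x %ℕ p                ≡⟨ FinP.toℕ-fromℕ< (n%ℕd<d x p) ⟨
    toℕ (residue x)       ≡⟨ cong toℕ (residue-cong x≈y) ⟩
    toℕ (residue y)       ≡⟨ FinP.toℕ-fromℕ< (n%ℕd<d y p) ⟩
    y %ℕ p                ∎
    where open ≡-Reasoning

  𝟙[_≈_] : ℤ → ℤ → ℤ
  𝟙[ x ≈ y ] = 𝟙 (x ≈? y)

  𝟙[≈]-yes : ∀ {x y} → x ≈ y → 𝟙[ x ≈ y ] ≡ + 1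
  𝟙[≈]-yes = 𝟙-yes

  𝟙[≈]-no : ∀ {x y} → x ≉ y → 𝟙[ x ≈ y ] ≡ + 0
  𝟙[≈]-no = 𝟙-no

  𝟙[≈]-⇔ : ∀ {x y u v} → x ≈ y ⇔ u ≈ v → 𝟙[ x ≈ y ] ≡ 𝟙[ u ≈ v ]
  𝟙[≈]-⇔ = 𝟙-⇔

  𝟙[≈]-cong : ∀ {x y u v} → x ≈ u → y ≈ v → 𝟙[ x ≈ y ] ≡ 𝟙[ u ≈ v ]
  𝟙[≈]-cong x≈u y≈v = 𝟙[≈]-⇔ (mk⇔ (λ x≈y → ≈-trans (≈-sym x≈u) (≈-trans x≈y y≈v))
                              (λ u≈v → ≈-trans x≈u (≈-trans u≈v (≈-sym y≈v))))

  𝟙[≈]-diff : ∀ {x y u v} → x - y ≡ u - v → 𝟙[ x ≈ y ] ≡ 𝟙[ u ≈ v ]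
  𝟙[≈]-diff eq = 𝟙[≈]-⇔ (mk⇔ (λ (mk≈ d) → ≈-via (sym eq) d) (λ (mk≈ d) → ≈-via eq d))

  -- Opaque, so that unifying ∑ₚ F with ∑ₚ G solves F := G instead of unfolding the fold.
  opaque
    ∑ₚ : (ℤ → ℤ) → ℤ
    ∑ₚ F = ∑[ i < p ] F (+ toℕ i)

    ∑ₚ-cong : ∀ {F G} → (∀ x → F x ≡ G x) → ∑ₚ F ≡ ∑ₚ G
    ∑ₚ-cong {F} {G} F≗G =
      sum-cong-≗ {p} {λ i → F (+ toℕ i)} {λ i → G (+ toℕ i)} (λ i → F≗G (+ toℕ i))

    ∑ₚ-distrib-+ : ∀ F G → ∑ₚ (λ x → F x + G x) ≡ ∑ₚ F + ∑ₚ G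
    ∑ₚ-distrib-+ F G = ∑-distrib-+ {p} (λ i → F (+ toℕ i)) (λ i → G (+ toℕ i))

    ∑ₚ-distrib-- : ∀ F G → ∑ₚ (λ x → F x - G x) ≡ ∑ₚ F - ∑ₚ G
    ∑ₚ-distrib-- F G = ∑-distrib-- {p} (λ i → F (+ toℕ i)) (λ i → G (+ toℕ i))

    ∑ₚ-comm : ∀ (H : ℤ → ℤ → ℤ) → ∑ₚ (λ x → ∑ₚ (λ y → H x y)) ≡ ∑ₚ (λ y → ∑ₚ (λ x → H x y))
    ∑ₚ-comm H = ∑-comm {p} {p} (λ i j → H (+ toℕ i) (+ toℕ j))

    ∑ₚ-const : ∀ k → ∑ₚ (λ _ → k) ≡ + p * k
    ∑ₚ-const = ∑-const p

    ∑ₚ-*ˡ : ∀ k F → ∑ₚ (λ x → k * F x) ≡ k * ∑ₚ F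
    ∑ₚ-*ˡ k F = sym (*-distribˡ-sum {p} k (λ i → F (+ toℕ i)))

    ∑ₚ-𝟙 : ∀ t → ∑ₚ (λ x → 𝟙[ x ≈ t ]) ≡ + 1
    ∑ₚ-𝟙 t =
      trans (∑-single (λ i → 𝟙[ + toℕ i ≈ t ]) (residue t) off) (𝟙[≈]-yes (residue-≈ t))
      where
        off : ∀ i → i ≢ residue t → 𝟙[ + toℕ i ≈ t ] ≡ + 0
        off i i≢r = 𝟙[≈]-no (λ i≈t → i≢r (trans (sym (residue-toℕ i)) (residue-cong i≈t)))

  ∑ₚ-1 : ∑ₚ (λ _ → + 1) ≡ + p
  ∑ₚ-1 = trans (∑ₚ-const (+ 1)) (ℤP.*-identityʳ (+ p))

  ∑ₚ-0 : ∑ₚ (λ _ → + 0) ≡ + 0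
  ∑ₚ-0 = trans (∑ₚ-const (+ 0)) (ℤP.*-zeroʳ (+ p))

  ∑ₚ-𝟙[≉0] : ∑ₚ (λ x → + 1 - 𝟙[ x ≈ + 0 ]) ≡ + p - + 1
  ∑ₚ-𝟙[≉0] =
    trans (∑ₚ-distrib-- (λ _ → + 1) (λ x → 𝟙[ x ≈ + 0 ])) (cong₂ _-_ ∑ₚ-1 (∑ₚ-𝟙 (+ 0)))

  IsSquare : ℤ → Set
  IsSquare x = ∃ λ y → y * y ≈ x

  hasSquareRoot : ℕ → Bool
  hasSquareRoot r = any (λ y → ⌊ (y ℕ.* y) ℕ.% p ℕ.≟ r ⌋) (upTo p)

  hasSquareRoot⇔IsSquare : ∀ x → T (hasSquareRoot (x %ℕ p)) ⇔ IsSquare x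
  hasSquareRoot⇔IsSquare x = mk⇔ to from
    where
      square-≈ : ∀ y → + y * + y ≈ + ((y ℕ.* y) ℕ.% p)
      square-≈ y = ≈-trans (≡⇒≈ (sym (ℤP.pos-* y y))) (≈-sym (%ℕ-≈ (+ (y ℕ.* y))))
      to : T (hasSquareRoot (x %ℕ p)) → IsSquare x
      to found with satisfied (any⁻ _ (upTo p) found)
      ... | y , y²≡x =
        + y , ≈-trans (square-≈ y) (≈-trans (≡⇒≈ (cong +_ (toWitness y²≡x))) (%ℕ-≈ x))
      from : IsSquare x → T (hasSquareRoot (x %ℕ p))
      from (y , y²≈x) = any⁺ _ (lose (∈-upTo⁺ (n%ℕd<d y p)) (fromWitness (%ℕ-cong r²≈x)))
        where
          r = y %ℕ p
          r²≈x : + (r ℕ.* r) ≈ x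
          r²≈x = ≈-trans (≡⇒≈ (ℤP.pos-* r r)) (≈-trans (*-cong (%ℕ-≈ y) (%ℕ-≈ y)) y²≈x)

  legendreᵣ : ℕ → ℤ
  legendreᵣ zero    = + 0
  legendreᵣ (suc k) = if hasSquareRoot (suc k) then + 1 else - + 1

  opaque
    χ : ℤ → ℤ
    χ x = legendre x p

    χ≡legendre : ∀ x → χ x ≡ legendre x p
    χ≡legendre x = refl

    χ≡legendreᵣ : ∀ x → χ x ≡ legendreᵣ (x %ℕ p)
    χ≡legendreᵣ x with x %ℕ p
    ... | zero  = refl
    ... | suc k = refl

  χ-cong : χ Preserves _≈_ ⟶ _≡_
  χ-cong {x} {y} x≈y =
    trans (χ≡legendreᵣ x) (trans (cong legendreᵣ (%ℕ-cong x≈y)) (sym (χ≡legendreᵣ y)))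

  χ-≈0 : ∀ {x} → x ≈ + 0 → χ x ≡ + 0
  χ-≈0 {x} x≈0 =
    trans (χ≡legendreᵣ x) (cong legendreᵣ (trans (%ℕ-cong x≈0) (ℕDM.m*n%n≡0 0 p)))

  χ-≉0 : ∀ {x} → x ≉ + 0 → χ x ≡ (if hasSquareRoot (x %ℕ p) then + 1 else - + 1)
  χ-≉0 {x} x≉0 = trans (χ≡legendreᵣ x) (legendreᵣ-≢0 (x %ℕ p) r≢0)
    where
      r≢0 : x %ℕ p ≢ 0
      r≢0 r≡0 = x≉0 (≈-trans (≈-sym (%ℕ-≈ x)) (≡⇒≈ (cong +_ r≡0)))
      legendreᵣ-≢0 : ∀ r → r ≢ 0 → legendreᵣ r ≡ (if hasSquareRoot r then + 1 else - + 1)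
      legendreᵣ-≢0 zero    r≢0 = ⊥-elim (r≢0 refl)
      legendreᵣ-≢0 (suc k) _   = refl

  χ-square : ∀ {x} → x ≉ + 0 → IsSquare x → χ x ≡ + 1
  χ-square {x} x≉0 sq = trans (χ-≉0 x≉0) (cong (λ b → if b then + 1 else - + 1)
    (Equivalence.to T-≡ (Equivalence.from (hasSquareRoot⇔IsSquare x) sq)))

  χ-nonsquare : ∀ {x} → x ≉ + 0 → ¬ IsSquare x → χ x ≡ - + 1
  χ-nonsquare {x} x≉0 ¬sq = trans (χ-≉0 x≉0) (cong (λ b → if b then + 1 else - + 1)
    (¬-not (¬sq ∘ Equivalence.to (hasSquareRoot⇔IsSquare x) ∘ Equivalence.from T-≡)))

  opaque
    IsSquare? : ∀ x → Dec (IsSquare x)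
    IsSquare? x = Dec-map (hasSquareRoot⇔IsSquare x) (T? _)

  module _ {m m⁻¹ : ℤ} (m*m⁻¹≈1 : m * m⁻¹ ≈ + 1) (e : ℤ) where
    private
      open SetoidReasoning ≈-setoid

      to : Fin p → Fin p
      to i = residue (m * + toℕ i + e)

      from : Fin p → Fin p
      from j = residue (m⁻¹ * (+ toℕ j - e))

      to∘from : ∀ j → to (from j) ≡ j
      to∘from j = +toℕ-injective (begin
        + toℕ (to (from j))                 ≈⟨ residue-≈ (m * i + e) ⟩
        m * i + e                           ≈⟨ +-cong (*-cong (≈-refl {m}) (residue-≈ (m⁻¹ * (y - e))))
                                                      (≈-refl {e}) ⟩
        m * (m⁻¹ * (y - e)) + e             ≡⟨ lemma m m⁻¹ y e ⟩
        m * m⁻¹ * (y - e) + e               ≈⟨ +-cong (*-cong m*m⁻¹≈1 (≈-refl {y - e})) (≈-refl {e}) ⟩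
        + 1 * (y - e) + e                   ≡⟨ lemma′ y e ⟩
        y                                   ∎)
        where i = + toℕ (from j)
              y = + toℕ j
              lemma : ∀ m m⁻¹ j e → m * (m⁻¹ * (j - e)) + e ≡ m * m⁻¹ * (j - e) + e
              lemma = solve-∀
              lemma′ : ∀ j e → + 1 * (j - e) + e ≡ j
              lemma′ = solve-∀

      from∘to : ∀ i → from (to i) ≡ i
      from∘to i = +toℕ-injective (begin
        + toℕ (from (to i))                 ≈⟨ residue-≈ (m⁻¹ * (y - e)) ⟩
        m⁻¹ * (y - e)                       ≈⟨ *-cong (≈-refl {m⁻¹})
                                                      (+-cong (residue-≈ (m * x + e)) (≈-refl { - e})) ⟩
        m⁻¹ * (m * x + e - e)               ≡⟨ lemma m m⁻¹ x e ⟩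
        m * m⁻¹ * x                         ≈⟨ *-cong m*m⁻¹≈1 (≈-refl {x}) ⟩
        + 1 * x                             ≡⟨ ℤP.*-identityˡ x ⟩
        x                                   ∎)
        where x = + toℕ i
              y = + toℕ (to i)
              lemma : ∀ m m⁻¹ i e → m⁻¹ * (m * i + e - e) ≡ m * m⁻¹ * i
              lemma = solve-∀

    affine : Permutation′ p
    affine = permutation to from to∘from from∘to

  opaque
    unfolding ∑ₚ

    ∑ₚ-affine-unit : ∀ {F} → F Preserves _≈_ ⟶ _≡_ →
                     ∀ {m m⁻¹} → m * m⁻¹ ≈ + 1 → ∀ e → ∑ₚ (λ x → F (m * x + e)) ≡ ∑ₚ F
    ∑ₚ-affine-unit {F} F-cong {m} {m⁻¹} m*m⁻¹≈1 e = sym (begin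
      ∑ₚ F                            ≡⟨ ∑-permute (λ j → F (+ toℕ j)) π ⟩
      ∑[ i < p ] F (+ toℕ (π ⟨$⟩ʳ i))
        ≡⟨ sum-cong-≗ {p} {λ i → F (+ toℕ (π ⟨$⟩ʳ i))} {λ i → F (m * + toℕ i + e)}
                      (λ i → F-cong (residue-≈ _)) ⟩
      ∑ₚ (λ x → F (m * x + e))        ∎)
      where
        open ≡-Reasoning
        π : Permutation′ p
        π = affine {m} {m⁻¹} m*m⁻¹≈1 e

    ∑ₚ-nonpos-≡0 : ∀ {F} → F Preserves _≈_ ⟶ _≡_ →
                   (∀ x → F x ≤ + 0) → ∑ₚ F ≡ + 0 → ∀ x → F x ≡ + 0
    ∑ₚ-nonpos-≡0 {F} F-cong F≤0 ∑F≡0 x = trans (F-cong (≈-sym (residue-≈ x)))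
      (∑-nonpos-≡0 (λ i → F (+ toℕ i)) (λ i → F≤0 (+ toℕ i)) ∑F≡0 (residue x))

    ∑ₚ-residues : ∀ F → sumℤ (map F (residues p)) ≡ ∑ₚ F
    ∑ₚ-residues F = sumℤ-applyUpTo F id p

module PrimeModulus (p : ℕ) .{{_ : ℕ.NonZero p}} (p-prime : Prime p) where
  open Congruence p

  p≢1 : p ≢ 1
  p≢1 = ℕ.nonTrivial⇒≢1 {{prime⇒nonTrivial p-prime}}

  euclid : ∀ {x y} → x * y ≈ + 0 → x ≈ + 0 ⊎ y ≈ + 0
  euclid {x} {y} xy≈0
    with euclidsLemma ∣ x ∣ ∣ y ∣ p-prime (subst (p ℕD.∣_) (ℤP.abs-* x y) (≈0⇒∣ᵤ xy≈0))
  ... | inj₁ p∣x = inj₁ (∣ᵤ⇒≈0 p∣x)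
  ... | inj₂ p∣y = inj₂ (∣ᵤ⇒≈0 p∣y)

  *-≉0 : ∀ {x y} → x ≉ + 0 → y ≉ + 0 → x * y ≉ + 0
  *-≉0 x≉0 y≉0 xy≈0 with euclid xy≈0
  ... | inj₁ x≈0 = x≉0 x≈0
  ... | inj₂ y≈0 = y≉0 y≈0

  inverse : ∀ {x} → x ≉ + 0 → ∃ λ y → x * y ≈ + 1
  inverse {x} x≉0 = map-inverse (coprime-Bézout (prime⇒coprime p-prime {{n≢0}} (n%ℕd<d x p)))
    where
      n = x %ℕ p
      n≢0 : ℕ.NonZero n
      n≢0 = ℕ.≢-nonZero (λ n≡0 → x≉0 (≈-trans (≈-sym (%ℕ-≈ x)) (≡⇒≈ (cong +_ n≡0))))
      ℤ-Bézout : ∀ a b c d → 1 ℕ.+ a ℕ.* b ≡ c ℕ.* d → + 1 + + a * + b ≡ + c * + d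
      ℤ-Bézout a b c d eq = begin
        + 1 + + a * + b    ≡⟨ cong (_+_ (+ 1)) (ℤP.pos-* a b) ⟨
        + (1 ℕ.+ a ℕ.* b)  ≡⟨ cong +_ eq ⟩
        + (c ℕ.* d)        ≡⟨ ℤP.pos-* c d ⟩
        + c * + d          ∎
        where open ≡-Reasoning
      p∣*p : ∀ c → + p S.∣ + c * + p
      p∣*p c = S.∣n⇒∣m*n (+ c) S.∣-refl
      map-inverse : Bézout.Identity 1 p n → ∃ λ y → x * y ≈ + 1
      map-inverse (Bézout.+- c a eq) = - + a , ≈-trans (*-cong (≈-sym (%ℕ-≈ x)) ≈-refl)
        (≈-via (trans (lemma (+ n) (+ a)) (cong -_ (ℤ-Bézout a n c p eq))) (S.∣m⇒∣-m (p∣*p c)))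
        where lemma : ∀ n a → n * - a - + 1 ≡ - (+ 1 + a * n)
              lemma = solve-∀
      map-inverse (Bézout.-+ c a eq) = + a , ≈-trans (*-cong (≈-sym (%ℕ-≈ x)) ≈-refl)
        (≈-via (begin
          + n * + a - + 1           ≡⟨ cong (_- + 1) (ℤP.*-comm (+ n) (+ a)) ⟩
          + a * + n - + 1           ≡⟨ cong (_- + 1) (ℤ-Bézout c p a n eq) ⟨
          + 1 + + c * + p - + 1     ≡⟨ lemma (+ c * + p) ⟩
          + c * + p                 ∎) (p∣*p c))
        where open ≡-Reasoning
              lemma : ∀ q → + 1 + q - + 1 ≡ q
              lemma = solve-∀

  ∑ₚ-affine : ∀ {F} → F Preserves _≈_ ⟶ _≡_ →
              ∀ {m} → m ≉ + 0 → ∀ e → ∑ₚ (λ x → F (m * x + e)) ≡ ∑ₚ F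
  ∑ₚ-affine F-cong {m} m≉0 e with inverse m≉0
  ... | m⁻¹ , m*m⁻¹≈1 = ∑ₚ-affine-unit F-cong {m} {m⁻¹} m*m⁻¹≈1 e

  ∑ₚ-𝟙-affine : ∀ {m} → m ≉ + 0 → ∀ e t → ∑ₚ (λ y → 𝟙[ m * y + e ≈ t ]) ≡ + 1
  ∑ₚ-𝟙-affine m≉0 e t = trans (∑ₚ-affine (λ x≈y → 𝟙[≈]-cong x≈y ≈-refl) m≉0 e) (∑ₚ-𝟙 t)

  ∑ₚ-𝟙-linear : ∀ {m} e → (m ≈ + 0 → e ≉ + 0) →
                ∑ₚ (λ y → 𝟙[ m * y + e ≈ + 0 ]) ≡ + 1 - 𝟙[ m ≈ + 0 ]
  ∑ₚ-𝟙-linear {m} e e≉0 with m ≈? + 0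
  ... | no m≉0  = ∑ₚ-𝟙-affine m≉0 e (+ 0)
  ... | yes m≈0 = trans (∑ₚ-cong (λ y → 𝟙[≈]-no (λ l≈0 → e≉0 m≈0 (≈-trans (≈-sym (l≈e y)) l≈0)))) ∑ₚ-0
    where l≈e : ∀ y → m * y + e ≈ e
          l≈e y = ≈-trans (+-cong (*-≈0ˡ y m≈0) (≈-refl {e})) (≡⇒≈ (ℤP.+-identityˡ e))

  gcd≡1⇔≉0 : ∀ x → gcd ∣ x ∣ p ≡ 1 ⇔ x ≉ + 0
  gcd≡1⇔≉0 x = mk⇔ to from
    where
      to : gcd ∣ x ∣ p ≡ 1 → x ≉ + 0
      to g≡1 x≈0 = p≢1 (ℕD.∣1⇒≡1 (subst (p ℕD.∣_) g≡1 (gcd-greatest (≈0⇒∣ᵤ x≈0) ℕD.∣-refl)))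
      from : x ≉ + 0 → gcd ∣ x ∣ p ≡ 1
      from x≉0 with prime⇒irreducible p-prime (gcd[m,n]∣n ∣ x ∣ p)
      ... | inj₁ g≡1 = g≡1
      ... | inj₂ g≡p = ⊥-elim (x≉0 (∣ᵤ⇒≈0 (subst (ℕD._∣ ∣ x ∣) g≡p (gcd[m,n]∣m ∣ x ∣ p))))

  𝟙[gcd≡1] : ∀ x → 𝟙 (gcd ∣ x ∣ p ℕ.≟ 1) ≡ + 1 - 𝟙[ x ≈ + 0 ]
  𝟙[gcd≡1] x = trans (𝟙-⇔ (gcd≡1⇔≉0 x)) (𝟙-¬ (x ≈? + 0))

  1≉0 : + 1 ≉ + 0
  1≉0 1≈0 = p≢1 (ℕD.∣1⇒≡1 (≈0⇒∣ᵤ 1≈0))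

module OddPrime (p : ℕ) .{{_ : ℕ.NonZero p}} (p-prime : Prime p) (p≢2 : p ≢ 2) where
  open Congruence p
  open PrimeModulus p p-prime

  2≉0 : + 2 ≉ + 0
  2≉0 2≈0 with irreducible[2] (≈0⇒∣ᵤ 2≈0)
  ... | inj₁ p≡1 = p≢1 p≡1
  ... | inj₂ p≡2 = p≢2 p≡2

  ≉0⇒≉- : ∀ {s} → s ≉ + 0 → s ≉ - s
  ≉0⇒≉- {s} s≉0 (mk≈ d) = *-≉0 2≉0 s≉0 (≈-via (lemma s) d)
    where lemma : ∀ s → + 2 * s - + 0 ≡ s - - s
          lemma = solve-∀

  ≈²⇒≈± : ∀ {y s} → y * y ≈ s * s → y ≈ s ⊎ y ≈ - s
  ≈²⇒≈± {y} {s} (mk≈ d) with euclid {y - s} {y + s} (≈-via (lemma y s) d)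
    where lemma : ∀ y s → (y - s) * (y + s) - + 0 ≡ y * y - s * s
          lemma = solve-∀
  ... | inj₁ y-s≈0 = inj₁ (mk≈ (≈0⇒∣ y-s≈0))
  ... | inj₂ y+s≈0 = inj₂ (≈-via (lemma y s) (≈0⇒∣ y+s≈0))
    where lemma : ∀ y s → y - - s ≡ y + s
          lemma = solve-∀

  ∑ₚ-𝟙[≈²]-≈0 : ∀ {x} → x ≈ + 0 → ∑ₚ (λ y → 𝟙[ x ≈ y * y ]) ≡ + 1
  ∑ₚ-𝟙[≈²]-≈0 {x} x≈0 = trans (∑ₚ-cong (λ y → 𝟙[≈]-⇔ (x≈y²⇔y≈0 y))) (∑ₚ-𝟙 (+ 0))
    where
      x≈y²⇔y≈0 : ∀ y → x ≈ y * y ⇔ y ≈ + 0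
      x≈y²⇔y≈0 y = mk⇔ to (λ y≈0 → ≈-trans x≈0 (≈-sym (*-cong y≈0 y≈0)))
        where to : x ≈ y * y → y ≈ + 0
              to x≈y² = [ id , id ]′ (euclid {y} {y} (≈-trans (≈-sym x≈y²) x≈0))

  ∑ₚ-𝟙[≈²]-nonsquare : ∀ {x} → ¬ IsSquare x → ∑ₚ (λ y → 𝟙[ x ≈ y * y ]) ≡ + 0
  ∑ₚ-𝟙[≈²]-nonsquare {x} ¬sq =
    trans (∑ₚ-cong (λ y → 𝟙[≈]-no (λ x≈y² → ¬sq (y , ≈-sym x≈y²)))) ∑ₚ-0

  ∑ₚ-𝟙[≈²]-square : ∀ {x} → x ≉ + 0 → IsSquare x → ∑ₚ (λ y → 𝟙[ x ≈ y * y ]) ≡ + 2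
  ∑ₚ-𝟙[≈²]-square {x} x≉0 (s , s²≈x) = begin
    ∑ₚ (λ y → 𝟙[ x ≈ y * y ])                        ≡⟨ ∑ₚ-cong split ⟩
    ∑ₚ (λ y → 𝟙[ y ≈ s ] + 𝟙[ y ≈ - s ])
      ≡⟨ ∑ₚ-distrib-+ (λ y → 𝟙[ y ≈ s ]) (λ y → 𝟙[ y ≈ - s ]) ⟩
    ∑ₚ (λ y → 𝟙[ y ≈ s ]) + ∑ₚ (λ y → 𝟙[ y ≈ - s ])  ≡⟨ cong₂ _+_ (∑ₚ-𝟙 s) (∑ₚ-𝟙 (- s)) ⟩
    + 2                                              ∎
    where
      open ≡-Reasoning
      s≉-s : s ≉ - s
      s≉-s = ≉0⇒≉- (λ s≈0 → x≉0 (≈-trans (≈-sym s²≈x) (*-cong s≈0 s≈0)))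
      neg² : ∀ s → - s * - s ≡ s * s
      neg² = solve-∀
      split : ∀ y → 𝟙[ x ≈ y * y ] ≡ 𝟙[ y ≈ s ] + 𝟙[ y ≈ - s ]
      split y with y ≈? s | y ≈? - s
      ... | yes y≈s | yes y≈-s = ⊥-elim (s≉-s (≈-trans (≈-sym y≈s) y≈-s))
      ... | yes y≈s | no _     = 𝟙[≈]-yes (≈-trans (≈-sym s²≈x) (*-cong (≈-sym y≈s) (≈-sym y≈s)))
      ... | no _    | yes y≈-s = 𝟙[≈]-yes (≈-trans (≈-sym s²≈x)
                                   (≈-trans (≡⇒≈ (sym (neg² s))) (*-cong (≈-sym y≈-s) (≈-sym y≈-s))))
      ... | no y≉s  | no y≉-s  = 𝟙[≈]-no (λ x≈y² →
                                   [ y≉s , y≉-s ]′ (≈²⇒≈± (≈-trans (≈-sym x≈y²) (≈-sym s²≈x))))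

  ∑ₚ-𝟙[≈²] : ∀ x → ∑ₚ (λ y → 𝟙[ x ≈ y * y ]) ≡ + 1 + χ x
  ∑ₚ-𝟙[≈²] x = cases (x ≈? + 0) (IsSquare? x)
    where
      cases : Dec (x ≈ + 0) → Dec (IsSquare x) → ∑ₚ (λ y → 𝟙[ x ≈ y * y ]) ≡ + 1 + χ x
      cases (yes x≈0) _ =
        trans (∑ₚ-𝟙[≈²]-≈0 x≈0) (sym (cong (_+_ (+ 1)) (χ-≈0 x≈0)))
      cases (no x≉0) (no ¬sq) =
        trans (∑ₚ-𝟙[≈²]-nonsquare ¬sq) (sym (cong (_+_ (+ 1)) (χ-nonsquare x≉0 ¬sq)))
      cases (no x≉0) (yes sq) =
        trans (∑ₚ-𝟙[≈²]-square x≉0 sq) (sym (cong (_+_ (+ 1)) (χ-square x≉0 sq)))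

  χ≡∑ₚ𝟙[≈²]-1 : ∀ x → χ x ≡ ∑ₚ (λ y → 𝟙[ x ≈ y * y ]) - + 1
  χ≡∑ₚ𝟙[≈²]-1 x = trans (lemma (χ x)) (cong (_- + 1) (sym (∑ₚ-𝟙[≈²] x)))
    where lemma : ∀ c → c ≡ + 1 + c - + 1
          lemma = solve-∀

  ∑ₚ-χ : ∑ₚ χ ≡ + 0
  ∑ₚ-χ = begin
    ∑ₚ χ                                              ≡⟨ ∑ₚ-cong χ≡∑ₚ𝟙[≈²]-1 ⟩
    ∑ₚ (λ x → ∑ₚ (λ y → 𝟙[ x ≈ y * y ]) - + 1)
      ≡⟨ ∑ₚ-distrib-- (λ x → ∑ₚ (λ y → 𝟙[ x ≈ y * y ])) (λ _ → + 1) ⟩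
    ∑ₚ (λ x → ∑ₚ (λ y → 𝟙[ x ≈ y * y ])) - ∑ₚ (λ _ → + 1)
      ≡⟨ cong (_- ∑ₚ (λ _ → + 1)) (∑ₚ-comm (λ x y → 𝟙[ x ≈ y * y ])) ⟩
    ∑ₚ (λ y → ∑ₚ (λ x → 𝟙[ x ≈ y * y ])) - ∑ₚ (λ _ → + 1)
      ≡⟨ cong (_- ∑ₚ (λ _ → + 1)) (∑ₚ-cong (λ y → ∑ₚ-𝟙 (y * y))) ⟩
    ∑ₚ (λ _ → + 1) - ∑ₚ (λ _ → + 1)                   ≡⟨ ℤP.+-inverseʳ (∑ₚ (λ _ → + 1)) ⟩
    + 0                                               ∎
    where open ≡-Reasoning

  -- Substituting u ↦ u + y turns the condition u² − d ≡ y² into 2u·y + (u² − d) ≡ 0, which is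
  -- linear in y: one solution for each u ≢ 0 and none for u ≡ 0, since d ≢ 0.
  ∑ₚ∑ₚ-𝟙[²-d≈²] : ∀ {d} → d ≉ + 0 → ∑ₚ (λ u → ∑ₚ (λ y → 𝟙[ u * u - d ≈ y * y ])) ≡ + p - + 1
  ∑ₚ∑ₚ-𝟙[²-d≈²] {d} d≉0 = begin
    ∑ₚ (λ u → ∑ₚ (λ y → 𝟙[ u * u - d ≈ y * y ]))
      ≡⟨ ∑ₚ-comm (λ u y → 𝟙[ u * u - d ≈ y * y ]) ⟩
    ∑ₚ (λ y → ∑ₚ (λ u → 𝟙[ u * u - d ≈ y * y ]))
      ≡⟨ ∑ₚ-cong (λ y → sym (∑ₚ-affine (²-d-cong y) 1≉0 y)) ⟩
    ∑ₚ (λ y → ∑ₚ (λ u → 𝟙[ (+ 1 * u + y) * (+ 1 * u + y) - d ≈ y * y ]))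
      ≡⟨ ∑ₚ-cong (λ y → ∑ₚ-cong (λ u → shift u y)) ⟩
    ∑ₚ (λ y → ∑ₚ (λ u → 𝟙[ (+ 2 * u) * y + (u * u - d) ≈ + 0 ]))
      ≡⟨ ∑ₚ-comm (λ y u → 𝟙[ (+ 2 * u) * y + (u * u - d) ≈ + 0 ]) ⟩
    ∑ₚ (λ u → ∑ₚ (λ y → 𝟙[ (+ 2 * u) * y + (u * u - d) ≈ + 0 ]))
      ≡⟨ ∑ₚ-cong line ⟩
    ∑ₚ (λ u → + 1 - 𝟙[ u ≈ + 0 ])
      ≡⟨ ∑ₚ-𝟙[≉0] ⟩
    + p - + 1 ∎
    where
      open ≡-Reasoning
      ²-d-cong : ∀ y → (λ u → 𝟙[ u * u - d ≈ y * y ]) Preserves _≈_ ⟶ _≡_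
      ²-d-cong y u≈v = 𝟙[≈]-cong (+-cong (*-cong u≈v u≈v) (≈-refl { - d})) (≈-refl {y * y})
      shift : ∀ u y → 𝟙[ (+ 1 * u + y) * (+ 1 * u + y) - d ≈ y * y ] ≡
                      𝟙[ (+ 2 * u) * y + (u * u - d) ≈ + 0 ]
      shift u y = 𝟙[≈]-diff {u = (+ 2 * u) * y + (u * u - d)} {v = + 0} (lemma u y d)
        where lemma : ∀ u y d → (+ 1 * u + y) * (+ 1 * u + y) - d - y * y ≡
                                (+ 2 * u) * y + (u * u - d) - + 0
              lemma = solve-∀
      line : ∀ u → ∑ₚ (λ y → 𝟙[ (+ 2 * u) * y + (u * u - d) ≈ + 0 ]) ≡ + 1 - 𝟙[ u ≈ + 0 ]
      line u = trans (∑ₚ-𝟙-linear (u * u - d) u²-d≉0) (cong (_-_ (+ 1)) (𝟙[≈]-⇔ 2u≈0⇔u≈0))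
        where
          2u≈0⇔u≈0 : + 2 * u ≈ + 0 ⇔ u ≈ + 0
          2u≈0⇔u≈0 = mk⇔ ([ ⊥-elim ∘ 2≉0 , id ]′ ∘ euclid {+ 2} {u}) (*-≈0ʳ (+ 2))
          u²-d≉0 : + 2 * u ≈ + 0 → u * u - d ≉ + 0
          u²-d≉0 2u≈0 u²-d≈0 = d≉0 (≈-trans (≡⇒≈ (lemma u d)) (+-cong (*-cong u≈0 u≈0) (-‿cong u²-d≈0)))
            where u≈0 = Equivalence.to 2u≈0⇔u≈0 2u≈0
                  lemma : ∀ u d → d ≡ u * u - (u * u - d)
                  lemma = solve-∀

  ∑ₚ-χ[²-d] : ∀ {d} → d ≉ + 0 → ∑ₚ (λ u → χ (u * u - d)) ≡ - + 1
  ∑ₚ-χ[²-d] {d} d≉0 = begin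
    ∑ₚ (λ u → χ (u * u - d))
      ≡⟨ ∑ₚ-cong (λ u → χ≡∑ₚ𝟙[≈²]-1 (u * u - d)) ⟩
    ∑ₚ (λ u → ∑ₚ (λ y → 𝟙[ u * u - d ≈ y * y ]) - + 1)
      ≡⟨ ∑ₚ-distrib-- (λ u → ∑ₚ (λ y → 𝟙[ u * u - d ≈ y * y ])) (λ _ → + 1) ⟩
    ∑ₚ (λ u → ∑ₚ (λ y → 𝟙[ u * u - d ≈ y * y ])) - ∑ₚ (λ _ → + 1)
      ≡⟨ cong₂ _-_ (∑ₚ∑ₚ-𝟙[²-d≈²] d≉0) ∑ₚ-1 ⟩
    + p - + 1 - + p
      ≡⟨ lemma (+ p) ⟩
    - + 1 ∎
    where
      open ≡-Reasoning
      lemma : ∀ p → p - + 1 - p ≡ - + 1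
      lemma = solve-∀

  χ≤1 : ∀ x → χ x ≤ + 1
  χ≤1 x with x ≈? + 0 | IsSquare? x
  ... | yes x≈0 | _      = subst (_≤ + 1) (sym (χ-≈0 x≈0)) (ℤ.+≤+ ℕ.z≤n)
  ... | no x≉0  | yes sq = ℤP.≤-reflexive (χ-square x≉0 sq)
  ... | no x≉0  | no ¬sq = subst (_≤ + 1) (sym (χ-nonsquare x≉0 ¬sq)) ℤ.-≤+

  IsSquare-*² : ∀ s z → IsSquare z → IsSquare (s * s * z)
  IsSquare-*² s z (t , t²≈z) = s * t , ≈-trans (≡⇒≈ (lemma s t)) (*-cong (≈-refl {s * s}) t²≈z)
    where lemma : ∀ s t → s * t * (s * t) ≡ s * s * (t * t)
          lemma = solve-∀

  IsSquare-*²⁻¹ : ∀ s z → s ≉ + 0 → IsSquare (s * s * z) → IsSquare z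
  IsSquare-*²⁻¹ s z s≉0 (w , w²≈s²z) with inverse s≉0
  ... | s⁻¹ , s*s⁻¹≈1 = s⁻¹ * w , (begin
    s⁻¹ * w * (s⁻¹ * w)                ≡⟨ lemma s⁻¹ w ⟩
    s⁻¹ * s⁻¹ * (w * w)                ≈⟨ *-cong (≈-refl {s⁻¹ * s⁻¹}) w²≈s²z ⟩
    s⁻¹ * s⁻¹ * (s * s * z)            ≡⟨ lemma′ s s⁻¹ z ⟩
    (s * s⁻¹) * (s * s⁻¹) * z          ≈⟨ *-cong (*-cong s*s⁻¹≈1 s*s⁻¹≈1) (≈-refl {z}) ⟩
    + 1 * + 1 * z                      ≡⟨ ℤP.*-identityˡ z ⟩
    z                                  ∎)
    where
      open SetoidReasoning ≈-setoid
      lemma : ∀ a w → a * w * (a * w) ≡ a * a * (w * w)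
      lemma = solve-∀
      lemma′ : ∀ s a z → a * a * (s * s * z) ≡ (s * a) * (s * a) * z
      lemma′ = solve-∀

  χ-*-square : ∀ s z → s ≉ + 0 → χ (s * s * z) ≡ χ z
  χ-*-square s z s≉0 with z ≈? + 0 | IsSquare? z
  ... | yes z≈0 | _ = trans (χ-≈0 (*-≈0ʳ (s * s) z≈0))
                            (sym (χ-≈0 z≈0))
  ... | no z≉0 | yes sq = trans (χ-square s²z≉0 (IsSquare-*² s z sq)) (sym (χ-square z≉0 sq))
    where s²z≉0 = *-≉0 (*-≉0 s≉0 s≉0) z≉0
  ... | no z≉0 | no ¬sq =
    trans (χ-nonsquare s²z≉0 (¬sq ∘ IsSquare-*²⁻¹ s z s≉0)) (sym (χ-nonsquare z≉0 ¬sq))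
    where s²z≉0 = *-≉0 (*-≉0 s≉0 s≉0) z≉0

  -- For a non-residue m, χ (m * w) + χ w ≤ 0 for every w, while χ (m * _) and χ both sum to 0
  -- over the residues; so every term vanishes, in particular at w = z.
  χ-*-nonsquare : ∀ m z → m ≉ + 0 → ¬ IsSquare m → z ≉ + 0 → ¬ IsSquare z → χ (m * z) ≡ + 1
  χ-*-nonsquare m z m≉0 ¬sqm z≉0 ¬sqz = begin
    χ (m * z)                ≡⟨ lemma (χ (m * z)) (χ z) ⟩
    χ (m * z) + χ z - χ z     ≡⟨ cong (_- χ z) (∑ₚ-nonpos-≡0 τ-cong τ≤0 ∑τ≡0 z) ⟩
    + 0 - χ z                ≡⟨ cong (_-_ (+ 0)) (χ-nonsquare z≉0 ¬sqz) ⟩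
    + 1                      ∎
    where
      open ≡-Reasoning
      lemma : ∀ a b → a ≡ a + b - b
      lemma = solve-∀
      τ : ℤ → ℤ
      τ w = χ (m * w) + χ w
      τ-cong : τ Preserves _≈_ ⟶ _≡_
      τ-cong w≈v = cong₂ _+_ (χ-cong (*-cong (≈-refl {m}) w≈v)) (χ-cong w≈v)
      τ≤0 : ∀ w → τ w ≤ + 0
      τ≤0 w with w ≈? + 0 | IsSquare? w
      ... | yes w≈0 | _ = ℤP.≤-reflexive (cong₂ _+_
            (χ-≈0 (*-≈0ʳ m w≈0)) (χ-≈0 w≈0))
      ... | no w≉0 | yes (s , s²≈w) = ℤP.≤-reflexive (cong₂ _+_
            (trans (χ-cong (≈-trans (*-cong (≈-refl {m}) (≈-sym s²≈w)) (≡⇒≈ (ℤP.*-comm m (s * s)))))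
                   (trans (χ-*-square s m (λ s≈0 → w≉0 (≈-trans (≈-sym s²≈w) (*-cong s≈0 s≈0))))
                          (χ-nonsquare m≉0 ¬sqm)))
            (χ-square w≉0 (s , s²≈w)))
      ... | no w≉0 | no ¬sq =
            subst (λ c → τ w ≤ + 1 + c) (χ-nonsquare w≉0 ¬sq) (ℤP.+-monoˡ-≤ (χ w) (χ≤1 (m * w)))
      ∑τ≡0 : ∑ₚ τ ≡ + 0
      ∑τ≡0 = begin
        ∑ₚ τ                                  ≡⟨ ∑ₚ-distrib-+ (λ w → χ (m * w)) χ ⟩
        ∑ₚ (λ w → χ (m * w)) + ∑ₚ χ
          ≡⟨ cong (_+ ∑ₚ χ) (∑ₚ-cong (λ w → cong χ (sym (ℤP.+-identityʳ (m * w))))) ⟩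
        ∑ₚ (λ w → χ (m * w + + 0)) + ∑ₚ χ     ≡⟨ cong (_+ ∑ₚ χ) (∑ₚ-affine χ-cong m≉0 (+ 0)) ⟩
        ∑ₚ χ + ∑ₚ χ                           ≡⟨ cong₂ _+_ ∑ₚ-χ ∑ₚ-χ ⟩
        + 0                                   ∎

  χ-* : ∀ x y → χ (x * y) ≡ χ x * χ y
  χ-* x y = cases (x ≈? + 0) (y ≈? + 0) (IsSquare? x) (IsSquare? y)
    where
      xy≈0 : x ≈ + 0 ⊎ y ≈ + 0 → x * y ≈ + 0
      xy≈0 (inj₁ x≈0) = *-≈0ˡ y x≈0
      xy≈0 (inj₂ y≈0) = *-≈0ʳ x y≈0
      s≉0 : ∀ {s z} → z ≉ + 0 → s * s ≈ z → s ≉ + 0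
      s≉0 z≉0 s²≈z s≈0 = z≉0 (≈-trans (≈-sym s²≈z) (*-cong s≈0 s≈0))
      cases : Dec (x ≈ + 0) → Dec (y ≈ + 0) → Dec (IsSquare x) → Dec (IsSquare y) →
              χ (x * y) ≡ χ x * χ y
      cases (yes x≈0) _ _ _ = trans (χ-≈0 (xy≈0 (inj₁ x≈0)))
        (sym (trans (cong (_* χ y) (χ-≈0 x≈0)) (ℤP.*-zeroˡ (χ y))))
      cases (no _) (yes y≈0) _ _ = trans (χ-≈0 (xy≈0 (inj₂ y≈0)))
        (sym (trans (cong (χ x *_) (χ-≈0 y≈0)) (ℤP.*-zeroʳ (χ x))))
      cases (no x≉0) (no _) (yes (s , s²≈x)) _ = begin
        χ (x * y)          ≡⟨ χ-cong (*-cong (≈-sym s²≈x) (≈-refl {y})) ⟩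
        χ (s * s * y)      ≡⟨ χ-*-square s y (s≉0 x≉0 s²≈x) ⟩
        χ y                ≡⟨ ℤP.*-identityˡ (χ y) ⟨
        + 1 * χ y          ≡⟨ cong (_* χ y) (χ-square x≉0 (s , s²≈x)) ⟨
        χ x * χ y          ∎
        where open ≡-Reasoning
      cases (no x≉0) (no y≉0) (no _) (yes (t , t²≈y)) = begin
        χ (x * y)
          ≡⟨ χ-cong (≈-trans (*-cong (≈-refl {x}) (≈-sym t²≈y)) (≡⇒≈ (ℤP.*-comm x (t * t)))) ⟩
        χ (t * t * x)      ≡⟨ χ-*-square t x (s≉0 y≉0 t²≈y) ⟩
        χ x                ≡⟨ ℤP.*-identityʳ (χ x) ⟨
        χ x * + 1          ≡⟨ cong (χ x *_) (χ-square y≉0 (t , t²≈y)) ⟨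
        χ x * χ y          ∎
        where open ≡-Reasoning
      cases (no x≉0) (no y≉0) (no ¬sqx) (no ¬sqy) = trans (χ-*-nonsquare x y x≉0 ¬sqx y≉0 ¬sqy)
        (sym (cong₂ _*_ (χ-nonsquare x≉0 ¬sqx) (χ-nonsquare y≉0 ¬sqy)))

  χ²≡1 : ∀ {x} → x ≉ + 0 → χ x * χ x ≡ + 1
  χ²≡1 {x} x≉0 = trans (sym (χ-* x x)) (χ-square (*-≉0 x≉0 x≉0) (x , ≈-refl {x * x}))

  ∑ₚ-χ[²] : ∑ₚ (λ u → χ (u * u)) ≡ + p - + 1
  ∑ₚ-χ[²] = trans (∑ₚ-cong χ[²]) ∑ₚ-𝟙[≉0]
    where
      χ[²] : ∀ u → χ (u * u) ≡ + 1 - 𝟙[ u ≈ + 0 ]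
      χ[²] u with u ≈? + 0
      ... | yes u≈0 = χ-≈0 (*-≈0ˡ u u≈0)
      ... | no u≉0  = χ-square (*-≉0 u≉0 u≉0) (u , ≈-refl {u * u})

module Quadratic (p : ℕ) .{{_ : ℕ.NonZero p}} (p-prime : Prime p) (p≢2 : p ≢ 2) (a b c : ℤ) where
  open Congruence p
  open PrimeModulus p p-prime
  open OddPrime p p-prime p≢2

  f : ℤ → ℤ
  f = quad a b c

  d : ℤ
  d = b * b - + 4 * a * c

  numerator : ℤ
  numerator = ∑ₚ (χ ∘ f)

  zeros : ℤ
  zeros = ∑ₚ (λ x → 𝟙[ f x ≈ + 0 ])

  apQuad≡ : apQuad a b c p ≡ divℚ numerator (+ p - zeros)
  apQuad≡ = cong₂ divℚ
    (trans (∑ₚ-residues _) (∑ₚ-cong (λ x → sym (χ≡legendre (f x)))))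
    (begin
      + length (filter coprime? (residues p))   ≡⟨ length-filter coprime? (residues p) ⟩
      sumℤ (map (𝟙 ∘ coprime?) (residues p))    ≡⟨ ∑ₚ-residues (𝟙 ∘ coprime?) ⟩
      ∑ₚ (𝟙 ∘ coprime?)                        ≡⟨ ∑ₚ-cong (𝟙[gcd≡1] ∘ f) ⟩
      ∑ₚ (λ x → + 1 - 𝟙[ f x ≈ + 0 ])          ≡⟨ ∑ₚ-distrib-- (λ _ → + 1) (λ x → 𝟙[ f x ≈ + 0 ]) ⟩
      ∑ₚ (λ _ → + 1) - zeros                   ≡⟨ cong (_- zeros) ∑ₚ-1 ⟩
      + p - zeros                              ∎)
    where
      open ≡-Reasoning
      coprime? : ∀ r → Dec (gcd ∣ quad a b c r ∣ p ≡ 1)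
      coprime? r = gcd ∣ quad a b c r ∣ p ℕ.≟ 1

  p-1≡suc : ∃ λ k → + p - + 1 ≡ + suc k
  p-1≡suc = go p (ℕ.nonTrivial⇒n>1 p {{prime⇒nonTrivial p-prime}})
    where go : ∀ n → 1 ℕ.< n → ∃ λ k → + n - + 1 ≡ + suc k
          go (suc (suc k)) _ = k , refl
          go (suc zero) (ℕ.s≤s ())

  completing-square : ∀ x → + 4 * a * f x ≡ (+ 2 * a * x + b) * (+ 2 * a * x + b) - d
  completing-square x = lemma a b c x
    where lemma : ∀ a b c x → + 4 * a * (a * x * x + b * x + c) ≡
                              (+ 2 * a * x + b) * (+ 2 * a * x + b) - (b * b - + 4 * a * c)
          lemma = solve-∀

  module _ (a≉0 : a ≉ + 0) where

    4a≉0 : + 4 * a ≉ + 0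
    4a≉0 = *-≉0 (*-≉0 2≉0 2≉0) a≉0

    χ∘f : ∀ x → χ (f x) ≡ χ a * χ ((+ 2 * a * x + b) * (+ 2 * a * x + b) - d)
    χ∘f x = begin
      χ (f x)                             ≡⟨ ℤP.*-identityˡ (χ (f x)) ⟨
      + 1 * χ (f x)                       ≡⟨ cong (_* χ (f x)) (χ²≡1 a≉0) ⟨
      χ a * χ a * χ (f x)                 ≡⟨ ℤP.*-assoc (χ a) (χ a) (χ (f x)) ⟩
      χ a * (χ a * χ (f x))               ≡⟨ cong (χ a *_) (χ-* a (f x)) ⟨
      χ a * χ (a * f x)                   ≡⟨ cong (χ a *_) (χ-*-square (+ 2) (a * f x) 2≉0) ⟨
      χ a * χ (+ 2 * + 2 * (a * f x))     ≡⟨ cong (λ t → χ a * χ t) (ℤP.*-assoc (+ 4) a (f x)) ⟨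
      χ a * χ (+ 4 * a * f x)             ≡⟨ cong (λ t → χ a * χ t) (completing-square x) ⟩
      χ a * χ ((+ 2 * a * x + b) * (+ 2 * a * x + b) - d) ∎
      where open ≡-Reasoning

    numerator≡χ[a]*∑ : numerator ≡ χ a * ∑ₚ (λ u → χ (u * u - d))
    numerator≡χ[a]*∑ = begin
      ∑ₚ (χ ∘ f)                                                     ≡⟨ ∑ₚ-cong χ∘f ⟩
      ∑ₚ (λ x → χ a * χ ((+ 2 * a * x + b) * (+ 2 * a * x + b) - d)) ≡⟨ ∑ₚ-*ˡ (χ a) _ ⟩
      χ a * ∑ₚ (λ x → χ ((+ 2 * a * x + b) * (+ 2 * a * x + b) - d))
        ≡⟨ cong (χ a *_) (∑ₚ-affine ²-d-cong (*-≉0 2≉0 a≉0) b) ⟩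
      χ a * ∑ₚ (λ u → χ (u * u - d))                                 ∎
      where
        open ≡-Reasoning
        ²-d-cong : (λ u → χ (u * u - d)) Preserves _≈_ ⟶ _≡_
        ²-d-cong u≈v = χ-cong (+-cong (*-cong u≈v u≈v) (≈-refl { - d}))

    f≈0⇔d≈w² : ∀ x → f x ≈ + 0 ⇔ d ≈ (+ 2 * a * x + b) * (+ 2 * a * x + b)
    f≈0⇔d≈w² x = mk⇔ to from
      where
        w = + 2 * a * x + b
        4af≡-[d-w²] : + 4 * a * f x ≡ - (d - w * w)
        4af≡-[d-w²] = trans (completing-square x) (lemma w d)
          where lemma : ∀ w d → w * w - d ≡ - (d - w * w)
                lemma = solve-∀
        to : f x ≈ + 0 → d ≈ w * w
        to fx≈0 = ≈-via (trans (sym (ℤP.neg-involutive (d - w * w))) (cong -_ (sym 4af≡-[d-w²])))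
                        (S.∣m⇒∣-m (≈0⇒∣ (*-≈0ʳ (+ 4 * a) fx≈0)))
        from : d ≈ w * w → f x ≈ + 0
        from (mk≈ p∣d-w²) = [ ⊥-elim ∘ 4a≉0 , id ]′ (euclid {+ 4 * a} {f x}
          (∣⇒≈0 (subst (+ p S.∣_) (sym 4af≡-[d-w²]) (S.∣m⇒∣-m p∣d-w²))))

    zeros≡1+χ[d] : zeros ≡ + 1 + χ d
    zeros≡1+χ[d] = begin
      ∑ₚ (λ x → 𝟙[ f x ≈ + 0 ])                                  ≡⟨ ∑ₚ-cong (λ x → 𝟙[≈]-⇔ (f≈0⇔d≈w² x)) ⟩
      ∑ₚ (λ x → 𝟙[ d ≈ (+ 2 * a * x + b) * (+ 2 * a * x + b) ])
        ≡⟨ ∑ₚ-affine (λ u≈v → 𝟙[≈]-cong (≈-refl {d}) (*-cong u≈v u≈v)) (*-≉0 2≉0 a≉0) b ⟩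
      ∑ₚ (λ u → 𝟙[ d ≈ u * u ])                                  ≡⟨ ∑ₚ-𝟙[≈²] d ⟩
      + 1 + χ d                                                  ∎
      where open ≡-Reasoning

    case-a≉0-d≉0 : d ≉ + 0 → apQuad a b c p ≡ divℚ (- legendre a p) (+ p - + 1 - legendre d p)
    case-a≉0-d≉0 d≉0 = trans apQuad≡ (cong₂ divℚ numerator≡-χ[a] p-zeros≡)
      where
        numerator≡-χ[a] : numerator ≡ - legendre a p
        numerator≡-χ[a] = begin
          numerator                      ≡⟨ numerator≡χ[a]*∑ ⟩
          χ a * ∑ₚ (λ u → χ (u * u - d)) ≡⟨ cong (χ a *_) (∑ₚ-χ[²-d] d≉0) ⟩
          χ a * - + 1                    ≡⟨ ℤP.*-comm (χ a) (- + 1) ⟩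
          - + 1 * χ a                    ≡⟨ ℤP.-1*i≡-i (χ a) ⟩
          - χ a                          ≡⟨ cong -_ (χ≡legendre a) ⟩
          - legendre a p                 ∎
          where open ≡-Reasoning
        p-zeros≡ : + p - zeros ≡ + p - + 1 - legendre d p
        p-zeros≡ = begin
          + p - zeros                    ≡⟨ cong (_-_ (+ p)) zeros≡1+χ[d] ⟩
          + p - (+ 1 + χ d)              ≡⟨ lemma (+ p) (χ d) ⟩
          + p - + 1 - χ d                ≡⟨ cong (_-_ (+ p - + 1)) (χ≡legendre d) ⟩
          + p - + 1 - legendre d p       ∎
          where open ≡-Reasoning
                lemma : ∀ p x → p - (+ 1 + x) ≡ p - + 1 - x
                lemma = solve-∀

    case-a≉0-d≈0 : d ≈ + 0 → apQuad a b c p ≡ legendre a p ℚ./ 1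
    case-a≉0-d≈0 d≈0 with p-1≡suc
    ... | k , p-1≡1+k = begin
      apQuad a b c p                                ≡⟨ apQuad≡ ⟩
      divℚ numerator (+ p - zeros)                  ≡⟨ cong₂ divℚ numerator≡χ[a]*[p-1] p-zeros≡ ⟩
      divℚ (legendre a p * + suc k) (+ suc k)        ≡⟨ divℚ-*-cancelʳ (legendre a p) (suc k) ⟩
      legendre a p ℚ./ 1                            ∎
      where
        open ≡-Reasoning
        ²-d≈² : ∀ u → u * u - d ≈ u * u
        ²-d≈² u = ≈-trans (+-cong (≈-refl {u * u}) (-‿cong d≈0)) (≡⇒≈ (ℤP.+-identityʳ (u * u)))
        numerator≡χ[a]*[p-1] : numerator ≡ legendre a p * + suc k
        numerator≡χ[a]*[p-1] = trans numerator≡χ[a]*∑ (cong₂ _*_ (χ≡legendre a)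
          (trans (∑ₚ-cong (χ-cong ∘ ²-d≈²)) (trans ∑ₚ-χ[²] p-1≡1+k)))
        p-zeros≡ : + p - zeros ≡ + suc k
        p-zeros≡ = trans (cong (_-_ (+ p)) (trans zeros≡1+χ[d] (cong (_+_ (+ 1)) (χ-≈0 d≈0)))) p-1≡1+k

  module _ (a≈0 : a ≈ + 0) where

    f≈linear : ∀ x → f x ≈ b * x + c
    f≈linear x = ≈-trans (+-cong (+-cong (*-≈0ˡ x (*-≈0ˡ x a≈0)) (≈-refl {b * x})) (≈-refl {c}))
                         (≡⇒≈ (cong (_+ c) (ℤP.+-identityˡ (b * x))))

    d≈b² : d ≈ b * b
    d≈b² = ≈-trans (+-cong (≈-refl {b * b}) (-‿cong (*-≈0ˡ c (*-≈0ʳ (+ 4) a≈0))))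
                   (≡⇒≈ (ℤP.+-identityʳ (b * b)))

    d≈0⇒b≈0 : d ≈ + 0 → b ≈ + 0
    d≈0⇒b≈0 d≈0 = [ id , id ]′ (euclid {b} {b} (≈-trans (≈-sym d≈b²) d≈0))

    case-a≈0-d≉0 : d ≉ + 0 → apQuad a b c p ≡ ℚ.0ℚ
    case-a≈0-d≉0 d≉0 with p-1≡suc
    ... | k , p-1≡1+k = begin
      apQuad a b c p                  ≡⟨ apQuad≡ ⟩
      divℚ numerator (+ p - zeros)    ≡⟨ cong₂ divℚ numerator≡0 (trans p-zeros≡ p-1≡1+k) ⟩
      divℚ (+ 0) (+ suc k)            ≡⟨ ℚP.0/n≡0 (suc k) ⟩
      ℚ.0ℚ                            ∎
      where
        open ≡-Reasoning
        b≉0 : b ≉ + 0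
        b≉0 b≈0 = d≉0 (≈-trans d≈b² (*-≈0ˡ b b≈0))
        numerator≡0 : numerator ≡ + 0
        numerator≡0 = begin
          numerator                  ≡⟨ ∑ₚ-cong (χ-cong ∘ f≈linear) ⟩
          ∑ₚ (λ x → χ (b * x + c))   ≡⟨ ∑ₚ-affine χ-cong b≉0 c ⟩
          ∑ₚ χ                       ≡⟨ ∑ₚ-χ ⟩
          + 0                        ∎
        p-zeros≡ : + p - zeros ≡ + p - + 1
        p-zeros≡ = cong (_-_ (+ p)) (trans (∑ₚ-cong (λ x → 𝟙[≈]-cong (f≈linear x) (≈-refl {+ 0})))
                                           (∑ₚ-𝟙-affine b≉0 c (+ 0)))

    case-a≈0-d≈0 : c ≉ + 0 → d ≈ + 0 → apQuad a b c p ≡ legendre c p ℚ./ 1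
    case-a≈0-d≈0 c≉0 d≈0 = begin
      apQuad a b c p                    ≡⟨ apQuad≡ ⟩
      divℚ numerator (+ p - zeros)
        ≡⟨ cong₂ divℚ numerator≡χ[c]*p (trans (cong (_-_ (+ p)) zeros≡0) (ℤP.+-identityʳ (+ p))) ⟩
      divℚ (legendre c p * + p) (+ p)   ≡⟨ divℚ-*-cancelʳ (legendre c p) p ⟩
      legendre c p ℚ./ 1                ∎
      where
        open ≡-Reasoning
        f≈c : ∀ x → f x ≈ c
        f≈c x = ≈-trans (f≈linear x)
                        (≈-trans (+-cong (*-≈0ˡ x (d≈0⇒b≈0 d≈0)) (≈-refl {c})) (≡⇒≈ (ℤP.+-identityˡ c)))
        numerator≡χ[c]*p : numerator ≡ legendre c p * + p
        numerator≡χ[c]*p = trans (∑ₚ-cong (λ x → trans (χ-cong (f≈c x)) (χ≡legendre c)))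
                           (trans (∑ₚ-const (legendre c p)) (ℤP.*-comm (+ p) (legendre c p)))
        zeros≡0 : zeros ≡ + 0
        zeros≡0 = trans (∑ₚ-cong (λ x → 𝟙[≈]-no (λ fx≈0 → c≉0 (≈-trans (≈-sym (f≈c x)) fx≈0)))) ∑ₚ-0

lemma4 : (a b c : ℤ) (p : ℕ) .{{_ : ℕ.NonZero p}} →
           a ≢ + 0 → Prime p → p ≢ 2 →
           ¬ ((+ p ∣ a) × (+ p ∣ b) × (+ p ∣ c)) →
           let d = b ℤ.* b ℤ.- + 4 ℤ.* a ℤ.* c in
           ((¬ (+ p ∣ a ℤ.* d)) →
              apQuad a b c p ≡ divℚ (ℤ.- legendre a p) (+ p ℤ.- + 1 ℤ.- legendre d p)) ×
           ((+ p ∣ a) → ¬ (+ p ∣ d) → apQuad a b c p ≡ ℚ.0ℚ) ×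
           ((¬ (+ p ∣ a)) → (+ p ∣ d) → apQuad a b c p ≡ legendre a p ℚ./ 1) ×
           ((+ p ∣ a) → (+ p ∣ d) → apQuad a b c p ≡ legendre c p ℚ./ 1)
lemma4 a b c p _ p-prime p≢2 p∤abc =
    (λ p∤ad → case-a≉0-d≉0 (λ a≈0 → p∤ad (≈0⇒∣ᵤ (*-≈0ˡ d a≈0)))
                           (λ d≈0 → p∤ad (≈0⇒∣ᵤ (*-≈0ʳ a d≈0))))
  , (λ p∣a p∤d → case-a≈0-d≉0 (∣ᵤ⇒≈0 p∣a) (p∤d ∘ ≈0⇒∣ᵤ))
  , (λ p∤a p∣d → case-a≉0-d≈0 (p∤a ∘ ≈0⇒∣ᵤ) (∣ᵤ⇒≈0 p∣d))
  , (λ p∣a p∣d → case-a≈0-d≈0 (∣ᵤ⇒≈0 p∣a) (c≉0 p∣a p∣d) (∣ᵤ⇒≈0 p∣d))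
  where
    open Congruence p
    open Quadratic p p-prime p≢2 a b c
    c≉0 : + p ∣ a → + p ∣ d → c ≉ + 0
    c≉0 p∣a p∣d c≈0 = p∤abc (p∣a , ≈0⇒∣ᵤ (d≈0⇒b≈0 (∣ᵤ⇒≈0 p∣a) (∣ᵤ⇒≈0 p∣d)) , ≈0⇒∣ᵤ c≈0)
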